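{- For every nonnegative integer $n$ the following hold. (1) $$\sum_{m=0}^{n} \binom{2m}{m}^2 \binom{n+m}{n-m} (-4)^{n-m} = \begin{cases} \binom{2k}{k}^2 & \text{if } n = 2k \text{ is even},\\ 0 & \text{if } n \text{ is odd}.\end{cases}$$ (2) $$\sum_{m=0}^{n} \binom{2m}{m}^2 \binom{n-1/2}{n-m} (-1)^m\, 16^{n-m} = \binom{2n}{n}^2.$$ (3) $$\sum_{m=0}^{n} \binom{2m}{m}^2 \frac{16^{n-m}}{1-2m} = (2n+1)\binom{2n}{n}^2.$$ (4) $$\sum_{m=0}^{2n} \binom{2m}{m}^2 \binom{2n+m}{2m} (-1)^m\, 4^{2n-m} = \binom{2n}{n}^2.$$
   Context: For a nonnegative integer $n$, $\binom{2n}{n} = \frac{(2n)!}{(n!)^2}$ is the central binomial coefficient. For a real number $a$ and a nonnegative integer $j$, the generalized binomial coefficient is $\binom{a}{j} = \frac{a(a-1)\cdots(a-j+1)}{j!}$ (with $\binom{a}{0}=1$); in particular $\binom{n-1/2}{n-m} = \frac{(n-\tfrac12)(n-\tfrac32)\cdots(m+\tfrac12)}{(n-m)!}$. -}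

module Defs where

open import Data.Nat as ℕ using (ℕ; zero; suc)
open import Data.Nat.Properties using (*-suc)
open import Data.Integer.Properties using (⊖-<)
open import Data.Integer as ℤ using (ℤ; +_; -[1+_])
open import Data.Rational as ℚ using (ℚ)
open import Data.Rational.Literals using (fromℤ)
open import Relation.Binary.PropositionalEquality using (_≡_; refl; subst; sym)

∑ℤ : ℕ → (ℕ → ℤ) → ℤ
∑ℤ zero    f = f zero
∑ℤ (suc n) f = ∑ℤ n f ℤ.+ f (suc n)

∑ℚ : ℕ → (ℕ → ℚ) → ℚ
∑ℚ zero    f = f zero
∑ℚ (suc n) f = ∑ℚ n f ℚ.+ f (suc n)

binomℚ : ℚ → ℕ → ℚ
binomℚ a zero    = ℚ.1ℚ
binomℚ a (suc j) = binomℚ a j ℚ.* (a ℚ.- fromℤ (+ j)) ℚ.* ((+ 1) ℚ./ suc j)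

oneMinusTwo : ℕ → ℚ
oneMinusTwo m = fromℤ (+ 1 ℤ.- + (2 ℕ.* m))

private
  aux : ∀ k → ℚ.NonZero (fromℤ (+ 1 ℤ.- + (suc (suc k))))
  aux k rewrite ⊖-< {1} {suc (suc k)} (ℕ.s≤s (ℕ.s≤s ℕ.z≤n)) = _

oneMinusTwo-nonZero : (m : ℕ) → ℚ.NonZero (oneMinusTwo m)
oneMinusTwo-nonZero zero = _
oneMinusTwo-nonZero (suc m) =
  subst (λ x → ℚ.NonZero (fromℤ (+ 1 ℤ.- + x))) (sym (*-suc 2 m)) (aux (2 ℕ.* m))

-- The sums behind (1) and (2) are Horner evaluations  Σₘ f(m) xⁿ⁻ᵐ,  handled by creative telescoping.
-- For (1) let F(n,m) = C(n+m,2m) C(2m,m)².  Zeilberger's algorithm finds a certificate G with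
--   (n+2)² F(n+2,m) − (n+1)² F(n,m) = G(m+1) + 4 G(m),   G(0) = 0,
-- and checking it only needs the term ratios of F and G, i.e. absorption (k+1) C(n+1,k+1) = (n+1) C(n,k),
-- its Pascal variant (k+1) C(n,k+1) = (n−k) C(n,k), and (j+1) C(2j+2,j+1) = 2(2j+1) C(2j,j).
-- Weighting by (−4)^{n+2−m} and summing telescopes to  (n+2)² S(n+2) = 16 (n+1)² S(n),  and with
-- S(0) = 1, S(1) = 0 this gives (1).  (4) is (1) at 2n, since C(2n+m,2m) = C(2n+m,2n−m) and
-- (−1)^m = (−1)^{2n−m}.  For (2), binom(n − 1/2, n−m) 4^{n−m} C(2m,m) = C(2n,n) C(n,m), so the sum is
-- C(2n,n) T(n) with T(n) = Σₘ (−1)^m C(n,m) C(2m,m) 4^{n−m}; the same method shows that T satisfies the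
-- recurrence (n+1) T(n+1) = 2(2n+1) T(n) of C(2n,n).  (3) is an induction on n using that recurrence.

{-# OPTIONS --safe #-}
module Submission where

open import Defs
open import Data.Nat as ℕ using (ℕ; zero; suc; _∸_)
open import Data.Nat.Combinatorics using (_C_)
open import Data.Integer as ℤ using (ℤ; +_)
open import Data.Rational as ℚ using (ℚ)
open import Data.Rational.Literals using (fromℤ)
open import Data.Product using (_×_; _,_)
open import Relation.Binary.PropositionalEquality
open import Data.List using (_∷_; [])

module BinomialCoefficients where

  open import Data.Nat using (_+_; _*_; _≤_; _<_; s≤s)
  open import Data.Nat.Properties
    using (*-zeroʳ; *-identityʳ; +-identityʳ; *-suc; *-assoc; +-suc; +-assoc; m≤m+n; m≤n+m; m+n∸m≡n; m∸n+n≡m)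
  open import Data.Nat.Combinatorics using (nCk+nC[k+1]≡[n+1]C[k+1]; nC1≡n; nCk≡nC[n∸k]; k>n⇒nCk≡0)
  open import Data.Nat.Tactic.RingSolver using (solve)
  open ≡-Reasoning

  private
    absorb-step : ∀ {n k a b x y} → a + b ≡ x → suc k * x ≡ suc n * a → suc (suc k) * y ≡ suc n * b →
                  suc (suc k) * (x + y) ≡ suc (suc n) * x
    absorb-step {n} {k} {a} {b} {y = y} refl kx≡na ky≡nb = begin
      suc (suc k) * ((a + b) + y)           ≡⟨ solve (k ∷ a ∷ b ∷ y ∷ []) ⟩
      suc k * (a + b) + (a + b) + suc (suc k) * y ≡⟨ cong₂ (λ p q → p + (a + b) + q) kx≡na ky≡nb ⟩
      suc n * a + (a + b) + suc n * b       ≡⟨ solve (n ∷ a ∷ b ∷ []) ⟩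
      suc (suc n) * (a + b)                 ∎

  C-absorb : ∀ n k → suc k * (suc n C suc k) ≡ suc n * (n C k)
  C-absorb zero    zero    = refl
  C-absorb zero    (suc k) = *-zeroʳ (suc (suc k))
  C-absorb (suc n) zero    =
    trans (+-identityʳ _) (trans (nC1≡n (suc (suc n))) (sym (*-identityʳ (suc (suc n)))))
  C-absorb (suc n) (suc k) =
    trans (cong (suc (suc k) *_) (sym (nCk+nC[k+1]≡[n+1]C[k+1] (suc n) (suc k))))
          (absorb-step {n} {k} (nCk+nC[k+1]≡[n+1]C[k+1] n k) (C-absorb n k) (C-absorb n (suc k)))

  C-symmetric : ∀ a b → (a + b) C a ≡ (a + b) C b
  C-symmetric a b = trans (nCk≡nC[n∸k] (m≤m+n a b)) (cong ((a + b) C_) (m+n∸m≡n a b))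

  C-symmetric-∸ : ∀ {n m} → m ≤ n → (n + m) C (n ∸ m) ≡ (n + m) C (2 * m)
  C-symmetric-∸ {n} {m} m≤n =
    subst (λ t → t C (n ∸ m) ≡ t C (2 * m)) n∸m+2m≡n+m (C-symmetric (n ∸ m) (2 * m))
    where
    n∸m+2m≡n+m : n ∸ m + 2 * m ≡ n + m
    n∸m+2m≡n+m = begin
      n ∸ m + 2 * m   ≡⟨ cong (λ t → n ∸ m + (m + t)) (+-identityʳ m) ⟩
      n ∸ m + (m + m) ≡⟨ sym (+-assoc (n ∸ m) m m) ⟩
      n ∸ m + m + m   ≡⟨ cong (_+ m) (m∸n+n≡m m≤n) ⟩
      n + m           ∎

  C-above : ∀ a b d → b ≡ suc d + a → a C b ≡ 0
  C-above a b d b≡1+d+a = k>n⇒nCk≡0 (subst (a <_) (sym b≡1+d+a) (s≤s (m≤n+m a d)))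

  central : ℕ → ℕ
  central j = 2 * j C j

  central-suc : ∀ j → suc j * central (suc j) ≡ 2 * (suc (2 * j) * central j)
  central-suc j = begin
    suc j * (2 * suc j C suc j)               ≡⟨ cong (λ t → suc j * (t C suc j)) (*-suc 2 j) ⟩
    suc j * (suc (suc (2 * j)) C suc j)       ≡⟨ C-absorb (suc (2 * j)) j ⟩
    suc (suc (2 * j)) * (suc (2 * j) C j)     ≡⟨ cong₂ _*_ (sym (*-suc 2 j)) middle-symmetric ⟩
    2 * suc j * (suc (2 * j) C suc j)         ≡⟨ *-assoc 2 (suc j) (suc (2 * j) C suc j) ⟩
    2 * (suc j * (suc (2 * j) C suc j))       ≡⟨ cong (2 *_) (C-absorb (2 * j) j) ⟩
    2 * (suc (2 * j) * central j)             ∎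
    where
    middle-symmetric : suc (2 * j) C j ≡ suc (2 * j) C suc j
    middle-symmetric = subst (λ t → t C j ≡ t C suc j)
      (trans (+-suc j j) (cong (λ t → suc (j + t)) (sym (+-identityʳ j)))) (C-symmetric j (suc j))

module IntegerBinomialRelations where

  open BinomialCoefficients
  open import Data.Integer using (_+_; _*_; _-_)
  open import Data.Integer.Properties using (pos-*; *-assoc)
  open import Data.Nat.Combinatorics using (nCk+nC[k+1]≡[n+1]C[k+1])
  open import Data.Integer.Tactic.RingSolver using (solve)
  open ≡-Reasoning

  ratio-chain : ∀ a b c d {x y z : ℤ} → a * x ≡ b * y → c * y ≡ d * z → a * c * x ≡ b * d * z
  ratio-chain a b c d {x} {y} {z} ax≡by cy≡dz = begin
    a * c * x   ≡⟨ solve (a ∷ c ∷ x ∷ []) ⟩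
    c * (a * x) ≡⟨ cong (c *_) ax≡by ⟩
    c * (b * y) ≡⟨ solve (b ∷ c ∷ y ∷ []) ⟩
    b * (c * y) ≡⟨ cong (b *_) cy≡dz ⟩
    b * (d * z) ≡⟨ solve (b ∷ d ∷ z ∷ []) ⟩
    b * d * z   ∎

  C-absorbℤ : ∀ n k → (+ 1 + + k) * + (suc n C suc k) ≡ (+ 1 + + n) * + (n C k)
  C-absorbℤ n k = trans (sym (pos-* (suc k) _)) (trans (cong +_ (C-absorb n k)) (pos-* (suc n) _))

  C-stepℤ : ∀ n k → (+ 1 + + k) * + (n C suc k) ≡ (+ n - + k) * + (n C k)
  C-stepℤ n k = pascal-absorb {+ n} {+ k} (cong +_ (sym (nCk+nC[k+1]≡[n+1]C[k+1] n k))) (C-absorbℤ n k)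
    where
    pascal-absorb : ∀ {n k x y p : ℤ} → p ≡ x + y → (+ 1 + k) * p ≡ (+ 1 + n) * x →
                    (+ 1 + k) * y ≡ (n - k) * x
    pascal-absorb {n} {k} {x} {y} refl kp≡nx = begin
      (+ 1 + k) * y                       ≡⟨ solve (k ∷ x ∷ y ∷ []) ⟩
      (+ 1 + k) * (x + y) - (+ 1 + k) * x ≡⟨ cong (_- (+ 1 + k) * x) kp≡nx ⟩
      (+ 1 + n) * x - (+ 1 + k) * x       ≡⟨ solve (n ∷ k ∷ x ∷ []) ⟩
      (n - k) * x                         ∎

  C-ratio₂ : ∀ n k → (+ 2 + + k) * (+ 1 + + k) * + (suc (suc n) C suc (suc k))
                   ≡ (+ 2 + + n) * (+ 1 + + n) * + (n C k)
  C-ratio₂ n k = ratio-chain (+ 2 + + k) (+ 2 + + n) (+ 1 + + k) (+ 1 + + n) (C-absorbℤ (suc n) (suc k)) (C-absorbℤ n k)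

  C-ratio₁ : ∀ n k → (+ 2 + + k) * (+ 1 + + k) * + (suc n C suc (suc k))
                   ≡ (+ 1 + + n) * (+ n - + k) * + (n C k)
  C-ratio₁ n k = ratio-chain (+ 2 + + k) (+ 1 + + n) (+ 1 + + k) (+ n - + k) (C-absorbℤ n (suc k)) (C-stepℤ n k)

  C-ratio₀ : ∀ n k → (+ 2 + + k) * (+ 1 + + k) * + (n C suc (suc k))
                   ≡ (+ n - (+ 1 + + k)) * (+ n - + k) * + (n C k)
  C-ratio₀ n k = ratio-chain (+ 2 + + k) (+ n - (+ 1 + + k)) (+ 1 + + k) (+ n - + k) (C-stepℤ n (suc k)) (C-stepℤ n k)

  central-sucℤ : ∀ j → (+ 1 + + j) * + central (suc j) ≡ + 2 * (+ 1 + + 2 * + j) * + central j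
  central-sucℤ j = begin
    (+ 1 + + j) * + central (suc j)         ≡⟨ sym (pos-* (suc j) (central (suc j))) ⟩
    + (suc j ℕ.* central (suc j))           ≡⟨ cong +_ (central-suc j) ⟩
    + (2 ℕ.* (suc (2 ℕ.* j) ℕ.* central j)) ≡⟨ pos-* 2 (suc (2 ℕ.* j) ℕ.* central j) ⟩
    + 2 * + (suc (2 ℕ.* j) ℕ.* central j)   ≡⟨ cong (+ 2 *_) (pos-* (suc (2 ℕ.* j)) (central j)) ⟩
    + 2 * ((+ 1 + + (2 ℕ.* j)) * + central j) ≡⟨ cong (λ t → + 2 * ((+ 1 + t) * + central j)) (pos-* 2 j) ⟩
    + 2 * ((+ 1 + + 2 * + j) * + central j) ≡⟨ sym (*-assoc (+ 2) (+ 1 + + 2 * + j) (+ central j)) ⟩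
    + 2 * (+ 1 + + 2 * + j) * + central j   ∎

module SignedPowers where

  open import Data.Integer using (_*_; -_; _^_)
  open import Data.Integer.Properties using (^-*-assoc; ^-zeroˡ; ^-distribˡ-+-*; *-identityˡ; *-identityʳ)
  open import Data.Integer.Tactic.RingSolver using (solve-∀)
  open import Data.Nat.Tactic.RingSolver using () renaming (solve to ℕ-solve)
  open ≡-Reasoning

  ^-distribʳ-* : ∀ a b n → (a * b) ^ n ≡ a ^ n * b ^ n
  ^-distribʳ-* a b zero    = refl
  ^-distribʳ-* a b (suc n) = trans (cong (a * b *_) (^-distribʳ-* a b n)) (interchange a b (a ^ n) (b ^ n))
    where
    interchange : ∀ a b x y → a * b * (x * y) ≡ a * x * (b * y)
    interchange = solve-∀

  -1^even : ∀ k → (- + 1) ^ (2 ℕ.* k) ≡ + 1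
  -1^even k = trans (sym (^-*-assoc (- + 1) 2 k)) (^-zeroˡ k)

  -1^-parity : ∀ {m j} k → m ℕ.+ j ≡ 2 ℕ.* k → (- + 1) ^ m ≡ (- + 1) ^ j
  -1^-parity {m} {j} k m+j≡2k = begin
    (- + 1) ^ m                             ≡⟨ sym (*-identityʳ _) ⟩
    (- + 1) ^ m * + 1                       ≡⟨ cong ((- + 1) ^ m *_) (sym (-1^even j)) ⟩
    (- + 1) ^ m * (- + 1) ^ (2 ℕ.* j)       ≡⟨ sym (^-distribˡ-+-* (- + 1) m (2 ℕ.* j)) ⟩
    (- + 1) ^ (m ℕ.+ 2 ℕ.* j)               ≡⟨ cong ((- + 1) ^_) exponents ⟩
    (- + 1) ^ (2 ℕ.* k ℕ.+ j)               ≡⟨ ^-distribˡ-+-* (- + 1) (2 ℕ.* k) j ⟩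
    (- + 1) ^ (2 ℕ.* k) * (- + 1) ^ j       ≡⟨ cong (_* (- + 1) ^ j) (-1^even k) ⟩
    + 1 * (- + 1) ^ j                       ≡⟨ *-identityˡ _ ⟩
    (- + 1) ^ j                             ∎
    where
    exponents : m ℕ.+ 2 ℕ.* j ≡ 2 ℕ.* k ℕ.+ j
    exponents = begin
      m ℕ.+ 2 ℕ.* j     ≡⟨ ℕ-solve (m ∷ j ∷ []) ⟩
      m ℕ.+ j ℕ.+ j     ≡⟨ cong (ℕ._+ j) m+j≡2k ⟩
      2 ℕ.* k ℕ.+ j     ∎

module HornerSums where

  open import Data.Nat using (_≤_; z≤n)
  open import Data.Nat.Properties using (≤-refl; m≤n⇒m≤1+n; +-∸-assoc; n∸n≡0)
  open import Data.Integer using (_+_; _*_; _-_; _^_; 0ℤ)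
  open import Data.Integer.Properties using (*-distribˡ-+; *-identityʳ; *-zeroʳ; +-identityʳ)
  open import Data.Integer.Tactic.RingSolver using (solve-∀)
  open ≡-Reasoning

  ∑ℤ-cong : ∀ k {f g : ℕ → ℤ} → (∀ {m} → m ≤ k → f m ≡ g m) → ∑ℤ k f ≡ ∑ℤ k g
  ∑ℤ-cong zero    f≗g = f≗g z≤n
  ∑ℤ-cong (suc k) f≗g = cong₂ _+_ (∑ℤ-cong k (λ m≤k → f≗g (m≤n⇒m≤1+n m≤k))) (f≗g ≤-refl)

  ∑ℤ-*ˡ : ∀ k x (f : ℕ → ℤ) → ∑ℤ k (λ m → x * f m) ≡ x * ∑ℤ k f
  ∑ℤ-*ˡ zero    x f = refl
  ∑ℤ-*ˡ (suc k) x f = trans (cong (_+ x * f (suc k)) (∑ℤ-*ˡ k x f)) (sym (*-distribˡ-+ x (∑ℤ k f) (f (suc k))))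

  horner : ℤ → (ℕ → ℤ) → ℕ → ℤ
  horner x f zero    = f zero
  horner x f (suc k) = x * horner x f k + f (suc k)

  ∑ℤ-horner : ∀ x (f : ℕ → ℤ) k → ∑ℤ k (λ m → f m * x ^ (k ∸ m)) ≡ horner x f k
  ∑ℤ-horner x f zero    = *-identityʳ (f zero)
  ∑ℤ-horner x f (suc k) = cong₂ _+_ shifted-sum last-term
    where
    shifted-sum : ∑ℤ k (λ m → f m * x ^ (suc k ∸ m)) ≡ x * horner x f k
    shifted-sum = begin
      ∑ℤ k (λ m → f m * x ^ (suc k ∸ m))   ≡⟨ ∑ℤ-cong k (λ {m} m≤k → pull-out m m≤k) ⟩
      ∑ℤ k (λ m → x * (f m * x ^ (k ∸ m))) ≡⟨ ∑ℤ-*ˡ k x _ ⟩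
      x * ∑ℤ k (λ m → f m * x ^ (k ∸ m))   ≡⟨ cong (x *_) (∑ℤ-horner x f k) ⟩
      x * horner x f k                      ∎
      where
      pull-out : ∀ m → m ≤ k → f m * x ^ (suc k ∸ m) ≡ x * (f m * x ^ (k ∸ m))
      pull-out m m≤k = trans (cong (λ e → f m * x ^ e) (+-∸-assoc 1 m≤k)) (swap (f m) x (x ^ (k ∸ m)))
        where
        swap : ∀ a b c → a * (b * c) ≡ b * (a * c)
        swap = solve-∀
    last-term : f (suc k) * x ^ (suc k ∸ suc k) ≡ f (suc k)
    last-term = trans (cong (λ e → f (suc k) * x ^ e) (n∸n≡0 k)) (*-identityʳ (f (suc k)))

  horner-linear : ∀ x a b (f g : ℕ → ℤ) k →
                  horner x (λ m → a * f m - b * g m) k ≡ a * horner x f k - b * horner x g k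
  horner-linear x a b f g zero    = refl
  horner-linear x a b f g (suc k) = begin
    x * horner x (λ m → a * f m - b * g m) k + (a * f (suc k) - b * g (suc k))
      ≡⟨ cong (λ h → x * h + (a * f (suc k) - b * g (suc k))) (horner-linear x a b f g k) ⟩
    x * (a * horner x f k - b * horner x g k) + (a * f (suc k) - b * g (suc k))
      ≡⟨ regroup x a b (horner x f k) (horner x g k) (f (suc k)) (g (suc k)) ⟩
    a * (x * horner x f k + f (suc k)) - b * (x * horner x g k + g (suc k)) ∎
    where
    regroup : ∀ x a b p q r s → x * (a * p - b * q) + (a * r - b * s) ≡ a * (x * p + r) - b * (x * q + s)
    regroup = solve-∀

  horner-telescoping : ∀ x {f g : ℕ → ℤ} → g 0 ≡ 0ℤ → (∀ m → f m ≡ g (suc m) - x * g m) →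
                       ∀ k → horner x f k ≡ g (suc k)
  horner-telescoping x {f} {g} g₀≡0 f≡Δg zero = begin
    f 0               ≡⟨ f≡Δg 0 ⟩
    g 1 - x * g 0     ≡⟨ cong (λ t → g 1 - x * t) g₀≡0 ⟩
    g 1 - x * 0ℤ      ≡⟨ cong (λ t → g 1 - t) (*-zeroʳ x) ⟩
    g 1 - 0ℤ          ≡⟨ +-identityʳ (g 1) ⟩
    g 1               ∎
  horner-telescoping x {f} {g} g₀≡0 f≡Δg (suc k) = begin
    x * horner x f k + f (suc k)
      ≡⟨ cong₂ (λ p q → x * p + q) (horner-telescoping x {f} {g} g₀≡0 f≡Δg k) (f≡Δg (suc k)) ⟩
    x * g (suc k) + (g (suc (suc k)) - x * g (suc k))
      ≡⟨ cancel (x * g (suc k)) (g (suc (suc k))) ⟩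
    g (suc (suc k)) ∎
    where
    cancel : ∀ a b → a + (b - a) ≡ b
    cancel = solve-∀

  horner-suc-zero : ∀ x (f : ℕ → ℤ) k → f (suc k) ≡ 0ℤ → horner x f (suc k) ≡ x * horner x f k
  horner-suc-zero x f k fₖ₊₁≡0 = trans (cong (λ t → x * horner x f k + t) fₖ₊₁≡0) (+-identityʳ _)

module Identity₁ where

  open BinomialCoefficients
  open IntegerBinomialRelations
  open SignedPowers
  open HornerSums
  open import Data.Nat.Properties using (*-suc; +-suc; m+[n∸m]≡n)
  open import Data.Integer using (_+_; _*_; _-_; -_; _^_; 0ℤ)
  open import Data.Integer.Properties using (pos-*; i-j≡0⇒i≡j; *-zeroʳ; *-cancelˡ-≡; *-identityʳ; *-assoc)
  open import Data.Integer.Tactic.RingSolver using (solve; solve-∀)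
  open import Data.Nat.Tactic.RingSolver using () renaming (solve to ℕ-solve)
  open import Function.Nary.NonDependent using (congₙ)
  open ≡-Reasoning

  summand₁ : ℕ → ℕ → ℤ
  summand₁ n m = + ((n ℕ.+ m) C (2 ℕ.* m)) * (+ central m * + central m)

  certificate₁ : ℕ → ℕ → ℤ
  certificate₁ n zero    = 0ℤ
  certificate₁ n (suc j) = (+ 2 * + n + + 3) * (+ 2 * + j + + 1) * (+ ((n ℕ.+ suc j) C (2 ℕ.* j)) * (+ central j * + central j))

  -- The hypotheses are the term ratios; multiplied by W both sides become polynomials in n, j, b and c₀.
  zeilberger₁-identity : ∀ (n j K b c₀ c₁ X₀ X₁ X₂ : ℤ) → K ≡ + 2 * j →
    let N = n + (+ 1 + j) in
    (+ 2 + K) * (+ 1 + K) * X₂ ≡ (+ 2 + N) * (+ 1 + N) * b →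
    (+ 2 + K) * (+ 1 + K) * X₁ ≡ (+ 1 + N) * (N - K) * b →
    (+ 2 + K) * (+ 1 + K) * X₀ ≡ (N - (+ 1 + K)) * (N - K) * b →
    (+ 1 + j) * c₁ ≡ + 2 * (+ 1 + + 2 * j) * c₀ →
    let W = (+ 2 + K) * (+ 1 + K) * ((+ 1 + j) * (+ 1 + j)) in
    W * ((+ 2 + n) * (+ 2 + n) * (X₂ * (c₁ * c₁)) - (+ 1 + n) * (+ 1 + n) * (X₀ * (c₁ * c₁)))
      ≡ W * ((+ 2 * n + + 3) * (+ 2 * (+ 1 + j) + + 1) * (X₁ * (c₁ * c₁))
             - - + 4 * ((+ 2 * n + + 3) * (+ 2 * j + + 1) * (b * (c₀ * c₀))))
  zeilberger₁-identity n j _ b c₀ c₁ X₀ X₁ X₂ refl ratio₂ ratio₁ ratio₀ central-rec =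
    let K = + 2 * j
        N = n + (+ 1 + j)
        K₂ = (+ 2 + K) * (+ 1 + K)
        W = K₂ * ((+ 1 + j) * (+ 1 + j))
    in i-j≡0⇒i≡j _ _ (begin
      W * ((+ 2 + n) * (+ 2 + n) * (X₂ * (c₁ * c₁)) - (+ 1 + n) * (+ 1 + n) * (X₀ * (c₁ * c₁)))
        - W * ((+ 2 * n + + 3) * (+ 2 * (+ 1 + j) + + 1) * (X₁ * (c₁ * c₁))
               - - + 4 * ((+ 2 * n + + 3) * (+ 2 * j + + 1) * (b * (c₀ * c₀))))
        ≡⟨ solve (n ∷ j ∷ b ∷ c₀ ∷ c₁ ∷ X₀ ∷ X₁ ∷ X₂ ∷ []) ⟩
      ((+ 2 + n) * (+ 2 + n) * (K₂ * X₂) - (+ 1 + n) * (+ 1 + n) * (K₂ * X₀)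
        - (+ 2 * n + + 3) * (+ 2 * j + + 3) * (K₂ * X₁)) * (((+ 1 + j) * c₁) * ((+ 1 + j) * c₁))
        - + 4 * (+ 2 * n + + 3) * (+ 2 * j + + 1) * W * (b * (c₀ * c₀))
        ≡⟨ congₙ 4 (λ A₂ A₀ A₁ D → ((+ 2 + n) * (+ 2 + n) * A₂ - (+ 1 + n) * (+ 1 + n) * A₀
                                    - (+ 2 * n + + 3) * (+ 2 * j + + 3) * A₁) * (D * D)
                                   - + 4 * (+ 2 * n + + 3) * (+ 2 * j + + 1) * W * (b * (c₀ * c₀)))
                   ratio₂ ratio₀ ratio₁ central-rec ⟩
      ((+ 2 + n) * (+ 2 + n) * ((+ 2 + N) * (+ 1 + N) * b) - (+ 1 + n) * (+ 1 + n) * ((N - (+ 1 + K)) * (N - K) * b)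
        - (+ 2 * n + + 3) * (+ 2 * j + + 3) * ((+ 1 + N) * (N - K) * b))
        * ((+ 2 * (+ 1 + + 2 * j) * c₀) * (+ 2 * (+ 1 + + 2 * j) * c₀))
        - + 4 * (+ 2 * n + + 3) * (+ 2 * j + + 1) * W * (b * (c₀ * c₀))
        ≡⟨ solve (n ∷ j ∷ b ∷ c₀ ∷ []) ⟩
      0ℤ ∎)

  zeilberger₁ : ∀ n m →
    (+ 2 + + n) * (+ 2 + + n) * summand₁ (suc (suc n)) m - (+ 1 + + n) * (+ 1 + + n) * summand₁ n m
      ≡ certificate₁ n (suc m) - - + 4 * certificate₁ n m
  zeilberger₁ n zero    = initial (+ n)
    where
    initial : ∀ n → (+ 2 + n) * (+ 2 + n) * (+ 1 * (+ 1 * + 1)) - (+ 1 + n) * (+ 1 + n) * (+ 1 * (+ 1 * + 1))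
                    ≡ (+ 2 * n + + 3) * (+ 2 * + 0 + + 1) * (+ 1 * (+ 1 * + 1)) - - + 4 * 0ℤ
    initial = solve-∀
  zeilberger₁ n (suc j) = *-cancelˡ-≡ ((+ 2 + + K) * (+ 1 + + K) * ((+ 1 + + j) * (+ 1 + + j))) _ _
    (zeilberger₁-identity (+ n) (+ j) (+ K) _ _ _ _ _ _ (pos-* 2 j) ratio₂ ratio₁ ratio₀ (central-sucℤ j))
    where
    N = n ℕ.+ suc j
    K = 2 ℕ.* j
    ratio₂ : (+ 2 + + K) * (+ 1 + + K) * + (suc (suc N) C (2 ℕ.* suc j)) ≡ (+ 2 + + N) * (+ 1 + + N) * + (N C K)
    ratio₂ = trans (cong (λ t → (+ 2 + + K) * (+ 1 + + K) * + (suc (suc N) C t)) (*-suc 2 j)) (C-ratio₂ N K)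
    ratio₁ : (+ 2 + + K) * (+ 1 + + K) * + ((n ℕ.+ suc (suc j)) C (2 ℕ.* suc j)) ≡ (+ 1 + + N) * (+ N - + K) * + (N C K)
    ratio₁ = trans (cong₂ (λ s t → (+ 2 + + K) * (+ 1 + + K) * + (s C t)) (+-suc n (suc j)) (*-suc 2 j)) (C-ratio₁ N K)
    ratio₀ : (+ 2 + + K) * (+ 1 + + K) * + (N C (2 ℕ.* suc j)) ≡ (+ N - (+ 1 + + K)) * (+ N - + K) * + (N C K)
    ratio₀ = trans (cong (λ t → (+ 2 + + K) * (+ 1 + + K) * + (N C t)) (*-suc 2 j)) (C-ratio₀ N K)

  summand₁-vanishes₁ : ∀ n → summand₁ n (suc n) ≡ 0ℤ
  summand₁-vanishes₁ n = cong (λ t → + t * (+ central (suc n) * + central (suc n)))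
    (C-above (n ℕ.+ suc n) (2 ℕ.* suc n) 0 (ℕ-solve (n ∷ [])))

  summand₁-vanishes₂ : ∀ n → summand₁ n (suc (suc n)) ≡ 0ℤ
  summand₁-vanishes₂ n = cong (λ t → + t * (+ central (suc (suc n)) * + central (suc (suc n))))
    (C-above (n ℕ.+ suc (suc n)) (2 ℕ.* suc (suc n)) 1 (ℕ-solve (n ∷ [])))

  certificate₁-vanishes : ∀ n → certificate₁ n (suc (suc (suc n))) ≡ 0ℤ
  certificate₁-vanishes n =
    trans (cong (λ t → (+ 2 * + n + + 3) * (+ 2 * + suc (suc n) + + 1) * (+ t * (+ central (suc (suc n)) * + central (suc (suc n)))))
                (C-above (n ℕ.+ suc (suc (suc n))) (2 ℕ.* suc (suc n)) 0 (ℕ-solve (n ∷ []))))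
          (*-zeroʳ ((+ 2 * + n + + 3) * (+ 2 * + suc (suc n) + + 1)))

  sum₁ : ℕ → ℤ
  sum₁ n = horner (- + 4) (summand₁ n) n

  sum₁-rec : ∀ n → (+ 2 + + n) * (+ 2 + + n) * sum₁ (suc (suc n)) ≡ + 16 * ((+ 1 + + n) * (+ 1 + + n) * sum₁ n)
  sum₁-rec n = i-j≡0⇒i≡j _ _ (begin
    a * sum₁ (suc (suc n)) - + 16 * (b * sum₁ n)
      ≡⟨ cong (λ t → a * sum₁ (suc (suc n)) - t) (sym (sixteen b (sum₁ n))) ⟩
    a * sum₁ (suc (suc n)) - b * (- + 4 * (- + 4 * sum₁ n))
      ≡⟨ cong (λ t → a * sum₁ (suc (suc n)) - b * t) (sym two-vanishing-terms) ⟩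
    a * sum₁ (suc (suc n)) - b * horner (- + 4) (summand₁ n) (suc (suc n))
      ≡⟨ sym (horner-linear (- + 4) a b (summand₁ (suc (suc n))) (summand₁ n) (suc (suc n))) ⟩
    horner (- + 4) (λ m → a * summand₁ (suc (suc n)) m - b * summand₁ n m) (suc (suc n))
      ≡⟨ horner-telescoping (- + 4) {g = certificate₁ n} refl (zeilberger₁ n) (suc (suc n)) ⟩
    certificate₁ n (suc (suc (suc n)))
      ≡⟨ certificate₁-vanishes n ⟩
    0ℤ ∎)
    where
    a = (+ 2 + + n) * (+ 2 + + n)
    b = (+ 1 + + n) * (+ 1 + + n)
    sixteen : ∀ b s → b * (- + 4 * (- + 4 * s)) ≡ + 16 * (b * s)
    sixteen = solve-∀
    two-vanishing-terms : horner (- + 4) (summand₁ n) (suc (suc n)) ≡ - + 4 * (- + 4 * sum₁ n)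
    two-vanishing-terms =
      trans (horner-suc-zero (- + 4) (summand₁ n) (suc n) (summand₁-vanishes₂ n))
            (cong (- + 4 *_) (horner-suc-zero (- + 4) (summand₁ n) n (summand₁-vanishes₁ n)))

  sum₁-even : ∀ k → sum₁ (2 ℕ.* k) ≡ + central k * + central k
  sum₁-even zero    = refl
  sum₁-even (suc k) = subst (λ t → sum₁ t ≡ + central (suc k) * + central (suc k)) (sym (*-suc 2 k))
    (*-cancelˡ-≡ ((+ 2 + + K) * (+ 2 + + K)) _ _ (begin
      (+ 2 + + K) * (+ 2 + + K) * sum₁ (suc (suc K))
        ≡⟨ sum₁-rec K ⟩
      + 16 * ((+ 1 + + K) * (+ 1 + + K) * sum₁ K)
        ≡⟨ cong (λ s → + 16 * ((+ 1 + + K) * (+ 1 + + K) * s)) (sum₁-even k) ⟩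
      + 16 * ((+ 1 + + K) * (+ 1 + + K) * (+ central k * + central k))
        ≡⟨ square-rec (+ k) (+ K) _ _ (pos-* 2 k) (central-sucℤ k) ⟩
      (+ 2 + + K) * (+ 2 + + K) * (+ central (suc k) * + central (suc k)) ∎))
    where
    K = 2 ℕ.* k
    square-rec : ∀ k K c c′ → K ≡ + 2 * k → (+ 1 + k) * c′ ≡ + 2 * (+ 1 + + 2 * k) * c →
                 + 16 * ((+ 1 + K) * (+ 1 + K) * (c * c)) ≡ (+ 2 + K) * (+ 2 + K) * (c′ * c′)
    square-rec k _ c c′ refl c-rec = begin
      + 16 * ((+ 1 + + 2 * k) * (+ 1 + + 2 * k) * (c * c)) ≡⟨ solve (k ∷ c ∷ []) ⟩
      + 4 * ((+ 2 * (+ 1 + + 2 * k) * c) * (+ 2 * (+ 1 + + 2 * k) * c)) ≡⟨ cong (λ t → + 4 * (t * t)) (sym c-rec) ⟩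
      + 4 * ((+ 1 + k) * c′ * ((+ 1 + k) * c′))           ≡⟨ solve (k ∷ c′ ∷ []) ⟩
      (+ 2 + + 2 * k) * (+ 2 + + 2 * k) * (c′ * c′)        ∎

  sum₁-odd : ∀ k → sum₁ (suc (2 ℕ.* k)) ≡ 0ℤ
  sum₁-odd zero    = refl
  sum₁-odd (suc k) = subst (λ t → sum₁ (suc t) ≡ 0ℤ) (sym (*-suc 2 k))
    (*-cancelˡ-≡ ((+ 2 + + K) * (+ 2 + + K)) _ _ (begin
      (+ 2 + + K) * (+ 2 + + K) * sum₁ (suc (suc K))
        ≡⟨ sum₁-rec K ⟩
      + 16 * ((+ 1 + + K) * (+ 1 + + K) * sum₁ K)
        ≡⟨ cong (λ s → + 16 * ((+ 1 + + K) * (+ 1 + + K) * s)) (sum₁-odd k) ⟩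
      + 16 * ((+ 1 + + K) * (+ 1 + + K) * 0ℤ)
        ≡⟨ annihilate ((+ 1 + + K) * (+ 1 + + K)) ((+ 2 + + K) * (+ 2 + + K)) ⟩
      (+ 2 + + K) * (+ 2 + + K) * 0ℤ ∎))
    where
    K = suc (2 ℕ.* k)
    annihilate : ∀ a b → + 16 * (a * 0ℤ) ≡ b * 0ℤ
    annihilate = solve-∀

  sum₁-spec : ∀ n → ∑ℤ n (λ m → (+ central m) ^ 2 * + ((n ℕ.+ m) C (n ∸ m)) * (- + 4) ^ (n ∸ m)) ≡ sum₁ n
  sum₁-spec n = trans (∑ℤ-cong n (λ {m} m≤n → cong (_* (- + 4) ^ (n ∸ m)) (summand-eq m≤n)))
                      (∑ℤ-horner (- + 4) (summand₁ n) n)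
    where
    summand-eq : ∀ {m} → m ℕ.≤ n → (+ central m) ^ 2 * + ((n ℕ.+ m) C (n ∸ m)) ≡ summand₁ n m
    summand-eq {m} m≤n = trans (cong (λ t → (+ central m) ^ 2 * + t) (C-symmetric-∸ m≤n))
                               (square-comm (+ central m) _)
      where
      square-comm : ∀ c b → c * (c * + 1) * b ≡ b * (c * c)
      square-comm = solve-∀

  identity₁-even : ∀ {n} k → n ≡ 2 ℕ.* k →
    ∑ℤ n (λ m → (+ central m) ^ 2 * + ((n ℕ.+ m) C (n ∸ m)) * (- + 4) ^ (n ∸ m)) ≡ (+ central k) ^ 2
  identity₁-even k refl =
    trans (sum₁-spec (2 ℕ.* k)) (trans (sum₁-even k) (cong (+ central k *_) (sym (*-identityʳ (+ central k)))))

  identity₁-odd : ∀ {n} k → n ≡ suc (2 ℕ.* k) →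
    ∑ℤ n (λ m → (+ central m) ^ 2 * + ((n ℕ.+ m) C (n ∸ m)) * (- + 4) ^ (n ∸ m)) ≡ 0ℤ
  identity₁-odd k refl = trans (sum₁-spec (suc (2 ℕ.* k))) (sum₁-odd k)

  identity₄ : ∀ n →
    ∑ℤ (2 ℕ.* n) (λ m → (+ central m) ^ 2 * + ((2 ℕ.* n ℕ.+ m) C (2 ℕ.* m)) * (- + 1) ^ m * (+ 4) ^ (2 ℕ.* n ∸ m))
      ≡ (+ central n) ^ 2
  identity₄ n = trans (∑ℤ-cong (2 ℕ.* n) summands-agree) (identity₁-even n refl)
    where
    summands-agree : ∀ {m} → m ℕ.≤ 2 ℕ.* n →
      (+ central m) ^ 2 * + ((2 ℕ.* n ℕ.+ m) C (2 ℕ.* m)) * (- + 1) ^ m * (+ 4) ^ (2 ℕ.* n ∸ m)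
        ≡ (+ central m) ^ 2 * + ((2 ℕ.* n ℕ.+ m) C (2 ℕ.* n ∸ m)) * (- + 4) ^ (2 ℕ.* n ∸ m)
    summands-agree {m} m≤2n = begin
      (+ central m) ^ 2 * + ((2 ℕ.* n ℕ.+ m) C (2 ℕ.* m)) * (- + 1) ^ m * (+ 4) ^ j
        ≡⟨ *-assoc ((+ central m) ^ 2 * + ((2 ℕ.* n ℕ.+ m) C (2 ℕ.* m))) ((- + 1) ^ m) ((+ 4) ^ j) ⟩
      (+ central m) ^ 2 * + ((2 ℕ.* n ℕ.+ m) C (2 ℕ.* m)) * ((- + 1) ^ m * (+ 4) ^ j)
        ≡⟨ cong₂ (λ b s → (+ central m) ^ 2 * + b * s) (sym (C-symmetric-∸ m≤2n)) signs ⟩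
      (+ central m) ^ 2 * + ((2 ℕ.* n ℕ.+ m) C j) * (- + 4) ^ j ∎
      where
      j = 2 ℕ.* n ∸ m
      signs : (- + 1) ^ m * (+ 4) ^ j ≡ (- + 4) ^ j
      signs = trans (cong (_* (+ 4) ^ j) (-1^-parity {m} {j} n (m+[n∸m]≡n m≤2n))) (sym (^-distribʳ-* (- + 1) (+ 4) j))

module CentralBinomialSum where

  open BinomialCoefficients
  open IntegerBinomialRelations
  open HornerSums
  open import Data.Integer using (_+_; _*_; _-_; -_; _^_; 0ℤ)
  open import Data.Integer.Properties using (i-j≡0⇒i≡j; *-zeroʳ; *-cancelˡ-≡)
  open import Data.Integer.Tactic.RingSolver using (solve; solve-∀)
  open import Function.Nary.NonDependent using (congₙ)
  open ≡-Reasoning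

  summand₂ : ℕ → ℕ → ℤ
  summand₂ n m = (- + 1) ^ m * (+ (n C m) * + central m)

  certificate₂ : ℕ → ℕ → ℤ
  certificate₂ n zero    = 0ℤ
  certificate₂ n (suc j) = (- + 1) ^ suc j * (+ 2 * + j + + 1) * (+ (n C j) * + central j)

  zeilberger₂-identity : ∀ (n j s b c₀ c₁ Y Z : ℤ) →
    (+ 1 + j) * Y ≡ (n - j) * b →
    (+ 1 + j) * Z ≡ (+ 1 + n) * b →
    (+ 1 + j) * c₁ ≡ + 2 * (+ 1 + + 2 * j) * c₀ →
    let W = (+ 1 + j) * (+ 1 + j) in
    W * ((+ 1 + + 2 * n) * (- + 1 * s * (Y * c₁)) - + 2 * (+ 1 + n) * (- + 1 * s * (Z * c₁)))
      ≡ W * (- + 1 * (- + 1 * s) * (+ 2 * (+ 1 + j) + + 1) * (Y * c₁) - + 4 * (- + 1 * s * (+ 2 * j + + 1) * (b * c₀)))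
  zeilberger₂-identity n j s b c₀ c₁ Y Z step absorb central-rec =
    let W = (+ 1 + j) * (+ 1 + j) in
    i-j≡0⇒i≡j _ _ (begin
      W * ((+ 1 + + 2 * n) * (- + 1 * s * (Y * c₁)) - + 2 * (+ 1 + n) * (- + 1 * s * (Z * c₁)))
        - W * (- + 1 * (- + 1 * s) * (+ 2 * (+ 1 + j) + + 1) * (Y * c₁) - + 4 * (- + 1 * s * (+ 2 * j + + 1) * (b * c₀)))
        ≡⟨ solve (n ∷ j ∷ s ∷ b ∷ c₀ ∷ c₁ ∷ Y ∷ Z ∷ []) ⟩
      s * (- (+ 1 + + 2 * n) - (+ 2 * j + + 3)) * ((+ 1 + j) * Y) * ((+ 1 + j) * c₁)
        + s * + 2 * (+ 1 + n) * ((+ 1 + j) * Z) * ((+ 1 + j) * c₁)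
        - + 4 * s * (+ 2 * j + + 1) * W * (b * c₀)
        ≡⟨ congₙ 3 (λ A B D → s * (- (+ 1 + + 2 * n) - (+ 2 * j + + 3)) * A * D
                              + s * + 2 * (+ 1 + n) * B * D
                              - + 4 * s * (+ 2 * j + + 1) * W * (b * c₀))
                   step absorb central-rec ⟩
      s * (- (+ 1 + + 2 * n) - (+ 2 * j + + 3)) * ((n - j) * b) * (+ 2 * (+ 1 + + 2 * j) * c₀)
        + s * + 2 * (+ 1 + n) * ((+ 1 + n) * b) * (+ 2 * (+ 1 + + 2 * j) * c₀)
        - + 4 * s * (+ 2 * j + + 1) * W * (b * c₀)
        ≡⟨ solve (n ∷ j ∷ s ∷ b ∷ c₀ ∷ []) ⟩
      0ℤ ∎)

  zeilberger₂ : ∀ n m →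
    (+ 1 + + 2 * + n) * summand₂ n m - + 2 * (+ 1 + + n) * summand₂ (suc n) m
      ≡ certificate₂ n (suc m) - + 4 * certificate₂ n m
  zeilberger₂ n zero    = initial (+ n)
    where
    initial : ∀ n → (+ 1 + + 2 * n) * (+ 1 * (+ 1 * + 1)) - + 2 * (+ 1 + n) * (+ 1 * (+ 1 * + 1))
                    ≡ - + 1 * + 1 * (+ 2 * + 0 + + 1) * (+ 1 * + 1) - + 4 * 0ℤ
    initial = solve-∀
  zeilberger₂ n (suc j) = *-cancelˡ-≡ ((+ 1 + + j) * (+ 1 + + j)) _ _
    (zeilberger₂-identity (+ n) (+ j) ((- + 1) ^ j) (+ (n C j)) (+ central j) (+ central (suc j))
                          (+ (n C suc j)) (+ (suc n C suc j)) (C-stepℤ n j) (C-absorbℤ n j) (central-sucℤ j))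

  summand₂-vanishes : ∀ n → summand₂ n (suc n) ≡ 0ℤ
  summand₂-vanishes n = trans (cong (λ t → (- + 1) ^ suc n * (+ t * + central (suc n))) (C-above n (suc n) 0 refl))
                              (*-zeroʳ ((- + 1) ^ suc n))

  certificate₂-vanishes : ∀ n → certificate₂ n (suc (suc n)) ≡ 0ℤ
  certificate₂-vanishes n =
    trans (cong (λ t → (- + 1) ^ suc (suc n) * (+ 2 * + suc n + + 1) * (+ t * + central (suc n))) (C-above n (suc n) 0 refl))
          (*-zeroʳ ((- + 1) ^ suc (suc n) * (+ 2 * + suc n + + 1)))

  sum₂ : ℕ → ℤ
  sum₂ n = horner (+ 4) (summand₂ n) n

  sum₂-rec : ∀ n → (+ 1 + + n) * sum₂ (suc n) ≡ + 2 * (+ 1 + + 2 * + n) * sum₂ n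
  sum₂-rec n = solve-recurrence (+ n) (sum₂ n) (sum₂ (suc n)) (begin
    (+ 1 + + 2 * + n) * (+ 4 * sum₂ n) - + 2 * (+ 1 + + n) * sum₂ (suc n)
      ≡⟨ cong (λ t → (+ 1 + + 2 * + n) * t - + 2 * (+ 1 + + n) * sum₂ (suc n))
              (sym (horner-suc-zero (+ 4) (summand₂ n) n (summand₂-vanishes n))) ⟩
    (+ 1 + + 2 * + n) * horner (+ 4) (summand₂ n) (suc n) - + 2 * (+ 1 + + n) * sum₂ (suc n)
      ≡⟨ sym (horner-linear (+ 4) (+ 1 + + 2 * + n) (+ 2 * (+ 1 + + n)) (summand₂ n) (summand₂ (suc n)) (suc n)) ⟩
    horner (+ 4) (λ m → (+ 1 + + 2 * + n) * summand₂ n m - + 2 * (+ 1 + + n) * summand₂ (suc n) m) (suc n)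
      ≡⟨ horner-telescoping (+ 4) {g = certificate₂ n} refl (zeilberger₂ n) (suc n) ⟩
    certificate₂ n (suc (suc n))
      ≡⟨ certificate₂-vanishes n ⟩
    0ℤ ∎)
    where
    solve-recurrence : ∀ n T T′ → (+ 1 + + 2 * n) * (+ 4 * T) - + 2 * (+ 1 + n) * T′ ≡ 0ℤ →
                       (+ 1 + n) * T′ ≡ + 2 * (+ 1 + + 2 * n) * T
    solve-recurrence n T T′ telescoped = *-cancelˡ-≡ (+ 2) _ _ (begin
      + 2 * ((+ 1 + n) * T′)              ≡⟨ solve (n ∷ T′ ∷ []) ⟩
      + 2 * (+ 1 + n) * T′                ≡⟨ sym (i-j≡0⇒i≡j _ _ telescoped) ⟩
      (+ 1 + + 2 * n) * (+ 4 * T)         ≡⟨ solve (n ∷ T ∷ []) ⟩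
      + 2 * (+ 2 * (+ 1 + + 2 * n) * T)   ∎)

  sum₂≡central : ∀ n → sum₂ n ≡ + central n
  sum₂≡central zero    = refl
  sum₂≡central (suc n) = *-cancelˡ-≡ (+ 1 + + n) _ _ (begin
    (+ 1 + + n) * sum₂ (suc n)          ≡⟨ sum₂-rec n ⟩
    + 2 * (+ 1 + + 2 * + n) * sum₂ n    ≡⟨ cong (+ 2 * (+ 1 + + 2 * + n) *_) (sum₂≡central n) ⟩
    + 2 * (+ 1 + + 2 * + n) * + central n ≡⟨ sym (central-sucℤ n) ⟩
    (+ 1 + + n) * + central (suc n)     ∎)

module RationalEmbedding where

  open import Data.Maybe using (nothing)
  open import Level using (0ℓ)
  open import Data.Nat.Coprimality using (1-coprimeTo)
  open import Data.Nat.Properties using (m≤n⇒m≤1+n; ≤-refl)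
  open import Data.Integer using (_+_; _*_; _-_; -_)
  open import Data.Integer.Tactic.RingSolver using (solve-∀)
  open import Data.Rational using (mkℚ; 1ℚ; NonZero; 1/_) renaming (_+_ to _+ℚ_; _*_ to _*ℚ_; _-_ to _-ℚ_; -_ to -ℚ_)
  open import Data.Rational.Properties
    using (+-*-commutativeRing; toℚᵘ-injective; toℚᵘ-homo-+; toℚᵘ-homo-*; toℚᵘ-homo‿-;
           ↥p/↧p≡p; *-inverseˡ; *-inverseʳ; *-assoc; *-identityʳ; *-distribˡ-+)
  import Data.Rational.Unnormalised.Base as ℚᵘ
  import Data.Rational.Unnormalised.Properties as ℚᵘ
  open import Tactic.RingSolver.Core.AlmostCommutativeRing using (AlmostCommutativeRing; fromCommutativeRing)

  ℚ-ring : AlmostCommutativeRing 0ℓ 0ℓ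
  ℚ-ring = fromCommutativeRing +-*-commutativeRing (λ _ → nothing)

  fromℤ-+ : ∀ i j → fromℤ (i + j) ≡ fromℤ i +ℚ fromℤ j
  fromℤ-+ i j = toℚᵘ-injective
    (ℚᵘ.≃-trans (ℚᵘ.*≡* (unit-denominators i j)) (ℚᵘ.≃-sym (toℚᵘ-homo-+ (fromℤ i) (fromℤ j))))
    where
    unit-denominators : ∀ i j → (i + j) * + 1 ≡ (i * + 1 + j * + 1) * + 1
    unit-denominators = solve-∀

  fromℤ-* : ∀ i j → fromℤ (i * j) ≡ fromℤ i *ℚ fromℤ j
  fromℤ-* i j = toℚᵘ-injective (ℚᵘ.≃-trans (ℚᵘ.*≡* refl) (ℚᵘ.≃-sym (toℚᵘ-homo-* (fromℤ i) (fromℤ j))))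

  fromℤ-neg : ∀ i → fromℤ (- i) ≡ -ℚ fromℤ i
  fromℤ-neg i = toℚᵘ-injective (ℚᵘ.≃-trans (ℚᵘ.*≡* refl) (ℚᵘ.≃-sym (toℚᵘ-homo‿- (fromℤ i))))

  fromℤ-minus : ∀ i j → fromℤ (i - j) ≡ fromℤ i -ℚ fromℤ j
  fromℤ-minus i j = trans (fromℤ-+ i (- j)) (cong (fromℤ i +ℚ_) (fromℤ-neg j))

  1/[1+n]*[1+n]≡1 : ∀ n → (+ 1) ℚ./ suc n *ℚ fromℤ (+ suc n) ≡ 1ℚ
  1/[1+n]*[1+n]≡1 n = trans (cong (_*ℚ fromℤ (+ suc n)) (↥p/↧p≡p (mkℚ (+ 1) n (1-coprimeTo (suc n)))))
                            (*-inverseˡ (fromℤ (+ suc n)))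

  *-cancelʳ-≡ : ∀ p q r .{{_ : NonZero r}} → p *ℚ r ≡ q *ℚ r → p ≡ q
  *-cancelʳ-≡ p q r pr≡qr = trans (sym (undo p)) (trans (cong (_*ℚ 1/ r) pr≡qr) (undo q))
    where
    undo : ∀ x → x *ℚ r *ℚ 1/ r ≡ x
    undo x = trans (*-assoc x r (1/ r)) (trans (cong (x *ℚ_) (*-inverseʳ r)) (*-identityʳ x))

  ∑ℚ-cong : ∀ k {f g : ℕ → ℚ} → (∀ {m} → m ℕ.≤ k → f m ≡ g m) → ∑ℚ k f ≡ ∑ℚ k g
  ∑ℚ-cong zero    f≗g = f≗g ℕ.z≤n
  ∑ℚ-cong (suc k) f≗g = cong₂ _+ℚ_ (∑ℚ-cong k (λ m≤k → f≗g (m≤n⇒m≤1+n m≤k))) (f≗g ≤-refl)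

  ∑ℚ-*ˡ : ∀ k x (f : ℕ → ℚ) → ∑ℚ k (λ m → x *ℚ f m) ≡ x *ℚ ∑ℚ k f
  ∑ℚ-*ˡ zero    x f = refl
  ∑ℚ-*ˡ (suc k) x f = trans (cong (_+ℚ x *ℚ f (suc k)) (∑ℚ-*ˡ k x f)) (sym (*-distribˡ-+ x (∑ℚ k f) (f (suc k))))

  ∑ℚ-fromℤ : ∀ k (f : ℕ → ℤ) → ∑ℚ k (λ m → fromℤ (f m)) ≡ fromℤ (∑ℤ k f)
  ∑ℚ-fromℤ zero    f = refl
  ∑ℚ-fromℤ (suc k) f = trans (cong (_+ℚ fromℤ (f (suc k))) (∑ℚ-fromℤ k f)) (sym (fromℤ-+ (∑ℤ k f) (f (suc k))))

module HalfIntegerBinomial where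

  open BinomialCoefficients
  open IntegerBinomialRelations
  open RationalEmbedding
  open import Data.Integer using (_+_; _*_; _-_; _^_)
  open import Data.Integer.Properties using (*-assoc; *-commutativeSemigroup)
  open import Data.Integer.Tactic.RingSolver using (solve-∀)
  open import Algebra.Properties.CommutativeSemigroup *-commutativeSemigroup using (x∙yz≈y∙xz)
  open import Data.Rational using (1ℚ) renaming (_*_ to _*ℚ_; _-_ to _-ℚ_)
  open import Data.Rational.Properties using (*-identityˡ; *-identityʳ) renaming (*-assoc to *ℚ-assoc)
  open import Data.Nat.Properties using (+-identityʳ; +-suc; m+[n∸m]≡n)
  open import Data.Nat.Combinatorics using (nCn≡1)
  open import Tactic.RingSolver using (solve)
  open ≡-Reasoning

  ½ : ℚ
  ½ = (+ 1) ℚ./ 2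

  binomℚ-suc-* : ∀ a j → binomℚ a (suc j) *ℚ fromℤ (+ suc j) ≡ binomℚ a j *ℚ (a -ℚ fromℤ (+ j))
  binomℚ-suc-* a j = begin
    binomℚ a j *ℚ (a -ℚ fromℤ (+ j)) *ℚ ((+ 1) ℚ./ suc j) *ℚ fromℤ (+ suc j)
      ≡⟨ *ℚ-assoc (binomℚ a j *ℚ (a -ℚ fromℤ (+ j))) ((+ 1) ℚ./ suc j) (fromℤ (+ suc j)) ⟩
    binomℚ a j *ℚ (a -ℚ fromℤ (+ j)) *ℚ (((+ 1) ℚ./ suc j) *ℚ fromℤ (+ suc j))
      ≡⟨ cong (binomℚ a j *ℚ (a -ℚ fromℤ (+ j)) *ℚ_) (1/[1+n]*[1+n]≡1 j) ⟩
    binomℚ a j *ℚ (a -ℚ fromℤ (+ j)) *ℚ 1ℚ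
      ≡⟨ *-identityʳ (binomℚ a j *ℚ (a -ℚ fromℤ (+ j))) ⟩
    binomℚ a j *ℚ (a -ℚ fromℤ (+ j)) ∎

  half-factor : ∀ m j → (fromℤ (+ suc (m ℕ.+ j)) -ℚ ½ -ℚ fromℤ (+ j)) *ℚ fromℤ (+ 4 * + central m)
                        ≡ fromℤ ((+ 1 + + m) * + central (suc m))
  half-factor m j = begin
    (fromℤ (+ 1 + (+ m + + j)) -ℚ ½ -ℚ fromℤ (+ j)) *ℚ fromℤ (+ 4 * c)
      ≡⟨ cong (λ t → (fromℤ (+ 1 + (+ m + + j)) -ℚ ½ -ℚ fromℤ (+ j)) *ℚ t)
              (trans (cong fromℤ (*-assoc (+ 2) (+ 2) c)) (fromℤ-* (+ 2) (+ 2 * c))) ⟩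
    (fromℤ (+ 1 + (+ m + + j)) -ℚ ½ -ℚ fromℤ (+ j)) *ℚ (fromℤ (+ 2) *ℚ fromℤ (+ 2 * c))
      ≡⟨ distribute (fromℤ (+ 1 + (+ m + + j))) ½ (fromℤ (+ j)) (fromℤ (+ 2)) (fromℤ (+ 2 * c)) ⟩
    (fromℤ (+ 1 + (+ m + + j)) *ℚ fromℤ (+ 2) -ℚ ½ *ℚ fromℤ (+ 2) -ℚ fromℤ (+ j) *ℚ fromℤ (+ 2)) *ℚ fromℤ (+ 2 * c)
      ≡⟨ cong₂ (λ x y → (x -ℚ 1ℚ -ℚ y) *ℚ fromℤ (+ 2 * c))
               (sym (fromℤ-* (+ 1 + (+ m + + j)) (+ 2))) (sym (fromℤ-* (+ j) (+ 2))) ⟩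
    (fromℤ ((+ 1 + (+ m + + j)) * + 2) -ℚ fromℤ (+ 1) -ℚ fromℤ (+ j * + 2)) *ℚ fromℤ (+ 2 * c)
      ≡⟨ cong (_*ℚ fromℤ (+ 2 * c))
               (sym (trans (fromℤ-minus ((+ 1 + (+ m + + j)) * + 2 - + 1) (+ j * + 2))
                           (cong (_-ℚ fromℤ (+ j * + 2)) (fromℤ-minus ((+ 1 + (+ m + + j)) * + 2) (+ 1))))) ⟩
    fromℤ ((+ 1 + (+ m + + j)) * + 2 - + 1 - + j * + 2) *ℚ fromℤ (+ 2 * c)
      ≡⟨ sym (fromℤ-* ((+ 1 + (+ m + + j)) * + 2 - + 1 - + j * + 2) (+ 2 * c)) ⟩
    fromℤ (((+ 1 + (+ m + + j)) * + 2 - + 1 - + j * + 2) * (+ 2 * c))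
      ≡⟨ cong fromℤ (trans (simplify (+ m) (+ j) c) (sym (central-sucℤ m))) ⟩
    fromℤ ((+ 1 + + m) * + central (suc m)) ∎
    where
    c = + central m
    distribute : ∀ x h y t u → (x -ℚ h -ℚ y) *ℚ (t *ℚ u) ≡ (x *ℚ t -ℚ h *ℚ t -ℚ y *ℚ t) *ℚ u
    distribute x h y t u = solve (x ∷ h ∷ y ∷ t ∷ u ∷ []) ℚ-ring
    simplify : ∀ m j c → ((+ 1 + (m + j)) * + 2 - + 1 - j * + 2) * (+ 2 * c) ≡ + 2 * (+ 1 + + 2 * m) * c
    simplify = solve-∀

  binomℚ-half-suc : ∀ m j → let a = fromℤ (+ suc (m ℕ.+ j)) -ℚ ½ in
    binomℚ a (suc j) *ℚ fromℤ (+ central m * (+ 4) ^ suc j) *ℚ fromℤ (+ suc j)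
      ≡ fromℤ (+ 1 + + m) *ℚ (binomℚ a j *ℚ fromℤ (+ central (suc m) * (+ 4) ^ j))
  binomℚ-half-suc m j = begin
    binomℚ a (suc j) *ℚ fromℤ (c * (+ 4) ^ suc j) *ℚ fromℤ (+ suc j)
      ≡⟨ swap (binomℚ a (suc j)) (fromℤ (c * (+ 4) ^ suc j)) (fromℤ (+ suc j)) ⟩
    binomℚ a (suc j) *ℚ fromℤ (+ suc j) *ℚ fromℤ (c * (+ 4) ^ suc j)
      ≡⟨ cong₂ _*ℚ_ (binomℚ-suc-* a j) (trans (cong fromℤ (split c ((+ 4) ^ j))) (fromℤ-* (+ 4 * c) ((+ 4) ^ j))) ⟩
    binomℚ a j *ℚ (a -ℚ fromℤ (+ j)) *ℚ (fromℤ (+ 4 * c) *ℚ fromℤ ((+ 4) ^ j))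
      ≡⟨ regroup (binomℚ a j) (a -ℚ fromℤ (+ j)) (fromℤ (+ 4 * c)) (fromℤ ((+ 4) ^ j)) ⟩
    binomℚ a j *ℚ ((a -ℚ fromℤ (+ j)) *ℚ fromℤ (+ 4 * c)) *ℚ fromℤ ((+ 4) ^ j)
      ≡⟨ cong (λ t → binomℚ a j *ℚ t *ℚ fromℤ ((+ 4) ^ j)) (trans (half-factor m j) (fromℤ-* (+ 1 + + m) c′)) ⟩
    binomℚ a j *ℚ (fromℤ (+ 1 + + m) *ℚ fromℤ c′) *ℚ fromℤ ((+ 4) ^ j)
      ≡⟨ regroup′ (binomℚ a j) (fromℤ (+ 1 + + m)) (fromℤ c′) (fromℤ ((+ 4) ^ j)) ⟩
    fromℤ (+ 1 + + m) *ℚ (binomℚ a j *ℚ (fromℤ c′ *ℚ fromℤ ((+ 4) ^ j)))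
      ≡⟨ cong (λ t → fromℤ (+ 1 + + m) *ℚ (binomℚ a j *ℚ t)) (sym (fromℤ-* c′ ((+ 4) ^ j))) ⟩
    fromℤ (+ 1 + + m) *ℚ (binomℚ a j *ℚ fromℤ (c′ * (+ 4) ^ j)) ∎
    where
    a = fromℤ (+ suc (m ℕ.+ j)) -ℚ ½
    c = + central m
    c′ = + central (suc m)
    split : ∀ c f → c * (+ 4 * f) ≡ + 4 * c * f
    split = solve-∀
    swap : ∀ b x y → b *ℚ x *ℚ y ≡ b *ℚ y *ℚ x
    swap b x y = solve (b ∷ x ∷ y ∷ []) ℚ-ring
    regroup : ∀ b x y z → b *ℚ x *ℚ (y *ℚ z) ≡ b *ℚ (x *ℚ y) *ℚ z
    regroup b x y z = solve (b ∷ x ∷ y ∷ z ∷ []) ℚ-ring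
    regroup′ : ∀ b p q r → b *ℚ (p *ℚ q) *ℚ r ≡ p *ℚ (b *ℚ (q *ℚ r))
    regroup′ b p q r = solve (b ∷ p ∷ q ∷ r ∷ []) ℚ-ring

  binomℚ-half : ∀ m j → binomℚ (fromℤ (+ (m ℕ.+ j)) -ℚ ½) j *ℚ fromℤ (+ central m * (+ 4) ^ j)
                        ≡ fromℤ (+ central (m ℕ.+ j) * + ((m ℕ.+ j) C m))
  binomℚ-half m zero =
    subst (λ t → 1ℚ *ℚ fromℤ (+ central m * + 1) ≡ fromℤ (+ central t * + (t C m))) (sym (+-identityʳ m))
          (trans (*-identityˡ (fromℤ (+ central m * + 1))) (cong (λ t → fromℤ (+ central m * + t)) (sym (nCn≡1 m))))
  binomℚ-half m (suc j) =
    subst (λ t → binomℚ (fromℤ (+ t) -ℚ ½) (suc j) *ℚ fromℤ (+ central m * (+ 4) ^ suc j) ≡ fromℤ (+ central t * + (t C m)))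
          (sym (+-suc m j))
          (*-cancelʳ-≡ _ _ (fromℤ (+ suc j)) (begin
      binomℚ a (suc j) *ℚ fromℤ (+ central m * (+ 4) ^ suc j) *ℚ fromℤ (+ suc j)
        ≡⟨ binomℚ-half-suc m j ⟩
      fromℤ (+ 1 + + m) *ℚ (binomℚ a j *ℚ fromℤ (+ central (suc m) * (+ 4) ^ j))
        ≡⟨ cong (fromℤ (+ 1 + + m) *ℚ_) (binomℚ-half (suc m) j) ⟩
      fromℤ (+ 1 + + m) *ℚ fromℤ (+ central N * + (N C suc m))
        ≡⟨ sym (fromℤ-* (+ 1 + + m) (+ central N * + (N C suc m))) ⟩
      fromℤ ((+ 1 + + m) * (+ central N * + (N C suc m)))
        ≡⟨ cong fromℤ (count (+ m) (+ j) (+ central N) _ _ (C-stepℤ N m)) ⟩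
      fromℤ (+ central N * + (N C m) * (+ 1 + + j))
        ≡⟨ fromℤ-* (+ central N * + (N C m)) (+ suc j) ⟩
      fromℤ (+ central N * + (N C m)) *ℚ fromℤ (+ suc j) ∎))
    where
    N = suc (m ℕ.+ j)
    a = fromℤ (+ N) -ℚ ½
    count : ∀ m j c x y → (+ 1 + m) * x ≡ ((+ 1 + (m + j)) - m) * y → (+ 1 + m) * (c * x) ≡ c * y * (+ 1 + j)
    count m j c x y step = begin
      (+ 1 + m) * (c * x)              ≡⟨ x∙yz≈y∙xz (+ 1 + m) c x ⟩
      c * ((+ 1 + m) * x)              ≡⟨ cong (c *_) step ⟩
      c * (((+ 1 + (m + j)) - m) * y)  ≡⟨ simplify m j c y ⟩
      c * y * (+ 1 + j)                ∎
      where
      simplify : ∀ m j c y → c * (((+ 1 + (m + j)) - m) * y) ≡ c * y * (+ 1 + j)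
      simplify = solve-∀

  binomℚ-half-∸ : ∀ {n m} → m ℕ.≤ n →
    binomℚ (fromℤ (+ n) -ℚ ½) (n ∸ m) *ℚ fromℤ (+ central m * (+ 4) ^ (n ∸ m)) ≡ fromℤ (+ central n * + (n C m))
  binomℚ-half-∸ {n} {m} m≤n = subst P (m+[n∸m]≡n m≤n) (binomℚ-half m (n ∸ m))
    where
    P : ℕ → Set
    P t = binomℚ (fromℤ (+ t) -ℚ ½) (n ∸ m) *ℚ fromℤ (+ central m * (+ 4) ^ (n ∸ m)) ≡ fromℤ (+ central t * + (t C m))

module Identity₂ where

  open BinomialCoefficients
  open HornerSums
  open SignedPowers
  open RationalEmbedding
  open HalfIntegerBinomial
  open CentralBinomialSum
  open import Data.Integer using (_*_; -_; _^_)
  open import Data.Integer.Properties using (*-identityʳ)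
  open import Data.Integer.Tactic.RingSolver using (solve-∀)
  open import Data.Rational using () renaming (_*_ to _*ℚ_; _-_ to _-ℚ_)
  open import Data.Rational.Properties using () renaming (*-assoc to *ℚ-assoc)
  open import Tactic.RingSolver using (solve)
  open ≡-Reasoning

  summand₂ℚ : ℕ → ℕ → ℚ
  summand₂ℚ n m =
    fromℤ ((+ central m) ^ 2) *ℚ binomℚ (fromℤ (+ n) -ℚ ½) (n ∸ m) *ℚ fromℤ ((- + 1) ^ m * (+ 16) ^ (n ∸ m))

  summand₂ℚ≡fromℤ : ∀ {n m} → m ℕ.≤ n →
    summand₂ℚ n m ≡ fromℤ (+ central n * (summand₂ n m * (+ 4) ^ (n ∸ m)))
  summand₂ℚ≡fromℤ {n} {m} m≤n = begin
    fromℤ (c ^ 2) *ℚ b *ℚ fromℤ (s * (+ 16) ^ j)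
      ≡⟨ cong (λ t → fromℤ (c ^ 2) *ℚ b *ℚ fromℤ (s * t)) (^-distribʳ-* (+ 4) (+ 4) j) ⟩
    fromℤ (c ^ 2) *ℚ b *ℚ fromℤ (s * (f * f))
      ≡⟨ regroup (fromℤ (c ^ 2)) b (fromℤ (s * (f * f))) ⟩
    b *ℚ (fromℤ (c ^ 2) *ℚ fromℤ (s * (f * f)))
      ≡⟨ cong (b *ℚ_) (sym (fromℤ-* (c ^ 2) (s * (f * f)))) ⟩
    b *ℚ fromℤ (c ^ 2 * (s * (f * f)))
      ≡⟨ cong (λ t → b *ℚ fromℤ t) (split c s f) ⟩
    b *ℚ fromℤ (c * f * (s * c * f))
      ≡⟨ cong (b *ℚ_) (fromℤ-* (c * f) (s * c * f)) ⟩
    b *ℚ (fromℤ (c * f) *ℚ fromℤ (s * c * f))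
      ≡⟨ sym (*ℚ-assoc b (fromℤ (c * f)) (fromℤ (s * c * f))) ⟩
    b *ℚ fromℤ (c * f) *ℚ fromℤ (s * c * f)
      ≡⟨ cong (_*ℚ fromℤ (s * c * f)) (binomℚ-half-∸ m≤n) ⟩
    fromℤ (+ central n * x) *ℚ fromℤ (s * c * f)
      ≡⟨ sym (fromℤ-* (+ central n * x) (s * c * f)) ⟩
    fromℤ (+ central n * x * (s * c * f))
      ≡⟨ cong fromℤ (merge (+ central n) x s c f) ⟩
    fromℤ (+ central n * (s * (x * c) * f)) ∎
    where
    j = n ∸ m
    c = + central m
    s = (- + 1) ^ m
    f = (+ 4) ^ j
    b = binomℚ (fromℤ (+ n) -ℚ ½) j
    x = + (n C m)
    regroup : ∀ p q r → p *ℚ q *ℚ r ≡ q *ℚ (p *ℚ r)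
    regroup p q r = solve (p ∷ q ∷ r ∷ []) ℚ-ring
    split : ∀ c s f → c * (c * + 1) * (s * (f * f)) ≡ c * f * (s * c * f)
    split = solve-∀
    merge : ∀ d x s c f → d * x * (s * c * f) ≡ d * (s * (x * c) * f)
    merge = solve-∀

  identity₂ : ∀ n → ∑ℚ n (summand₂ℚ n) ≡ fromℤ ((+ central n) ^ 2)
  identity₂ n = begin
    ∑ℚ n (summand₂ℚ n)
      ≡⟨ ∑ℚ-cong n summand₂ℚ≡fromℤ ⟩
    ∑ℚ n (λ m → fromℤ (+ central n * (summand₂ n m * (+ 4) ^ (n ∸ m))))
      ≡⟨ ∑ℚ-fromℤ n (λ m → + central n * (summand₂ n m * (+ 4) ^ (n ∸ m))) ⟩
    fromℤ (∑ℤ n (λ m → + central n * (summand₂ n m * (+ 4) ^ (n ∸ m))))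
      ≡⟨ cong fromℤ (∑ℤ-*ˡ n (+ central n) (λ m → summand₂ n m * (+ 4) ^ (n ∸ m))) ⟩
    fromℤ (+ central n * ∑ℤ n (λ m → summand₂ n m * (+ 4) ^ (n ∸ m)))
      ≡⟨ cong (λ t → fromℤ (+ central n * t)) (trans (∑ℤ-horner (+ 4) (summand₂ n) n) (sum₂≡central n)) ⟩
    fromℤ (+ central n * + central n)
      ≡⟨ cong (λ t → fromℤ (+ central n * t)) (sym (*-identityʳ (+ central n))) ⟩
    fromℤ ((+ central n) ^ 2) ∎

module Identity₃ where

  open BinomialCoefficients
  open IntegerBinomialRelations
  open RationalEmbedding
  open import Data.Integer using (_+_; _*_; _-_; _^_)
  open import Data.Integer.Properties using (pos-*; i-j≡0⇒i≡j; *-commutativeSemigroup)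
  open import Algebra.Properties.CommutativeSemigroup *-commutativeSemigroup using (x∙yz≈y∙xz)
  open import Data.Integer.Tactic.RingSolver using () renaming (solve to ℤ-solve)
  open import Data.Nat.Properties using (+-∸-assoc; n∸n≡0)
  open import Data.Rational using (1/_; _÷_) renaming (_+_ to _+ℚ_; _*_ to _*ℚ_)
  open import Data.Rational.Properties using (*-inverseˡ) renaming (*-assoc to *ℚ-assoc)
  open import Tactic.RingSolver using (solve)
  open ≡-Reasoning

  summand₃ : ℕ → ℕ → ℚ
  summand₃ n m = (fromℤ ((+ central m) ^ 2 * (+ 16) ^ (n ∸ m)) ÷ oneMinusTwo m) {{oneMinusTwo-nonZero m}}

  summand₃-suc : ∀ {n m} → m ℕ.≤ n → summand₃ (suc n) m ≡ fromℤ (+ 16) *ℚ summand₃ n m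
  summand₃-suc {n} {m} m≤n = begin
    fromℤ ((+ central m) ^ 2 * (+ 16) ^ (suc n ∸ m)) *ℚ d⁻¹
      ≡⟨ cong (λ e → fromℤ ((+ central m) ^ 2 * (+ 16) ^ e) *ℚ d⁻¹) (+-∸-assoc 1 m≤n) ⟩
    fromℤ ((+ central m) ^ 2 * (+ 16 * (+ 16) ^ (n ∸ m))) *ℚ d⁻¹
      ≡⟨ cong (λ t → fromℤ t *ℚ d⁻¹) (x∙yz≈y∙xz ((+ central m) ^ 2) (+ 16) ((+ 16) ^ (n ∸ m))) ⟩
    fromℤ (+ 16 * ((+ central m) ^ 2 * (+ 16) ^ (n ∸ m))) *ℚ d⁻¹
      ≡⟨ cong (_*ℚ d⁻¹) (fromℤ-* (+ 16) ((+ central m) ^ 2 * (+ 16) ^ (n ∸ m))) ⟩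
    fromℤ (+ 16) *ℚ fromℤ ((+ central m) ^ 2 * (+ 16) ^ (n ∸ m)) *ℚ d⁻¹
      ≡⟨ *ℚ-assoc (fromℤ (+ 16)) (fromℤ ((+ central m) ^ 2 * (+ 16) ^ (n ∸ m))) d⁻¹ ⟩
    fromℤ (+ 16) *ℚ summand₃ n m ∎
    where
    d⁻¹ = (1/ oneMinusTwo m) {{oneMinusTwo-nonZero m}}

  identity₃-step : ∀ n a d r c c′ →
    a ≡ + 2 * n + + 1 → d ≡ + 1 - + 2 * (+ 1 + n) → r ≡ + 2 * (+ 1 + n) + + 1 →
    (+ 1 + n) * c′ ≡ + 2 * (+ 1 + + 2 * n) * c →
    + 16 * (a * (c * (c * + 1))) * d + c′ * (c′ * + 1) * + 1 * + 1 ≡ r * (c′ * (c′ * + 1)) * d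
  identity₃-step n _ _ _ c c′ refl refl refl c-rec = i-j≡0⇒i≡j _ _ (begin
    + 16 * ((+ 2 * n + + 1) * (c * (c * + 1))) * (+ 1 - + 2 * (+ 1 + n)) + c′ * (c′ * + 1) * + 1 * + 1
      - (+ 2 * (+ 1 + n) + + 1) * (c′ * (c′ * + 1)) * (+ 1 - + 2 * (+ 1 + n))
      ≡⟨ ℤ-solve (n ∷ c ∷ c′ ∷ []) ⟩
    + 4 * (((+ 1 + n) * c′) * ((+ 1 + n) * c′) - (+ 2 * (+ 1 + + 2 * n) * c) * (+ 2 * (+ 1 + + 2 * n) * c))
      ≡⟨ cong (λ t → + 4 * (t * t - (+ 2 * (+ 1 + + 2 * n) * c) * (+ 2 * (+ 1 + + 2 * n) * c))) c-rec ⟩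
    + 4 * ((+ 2 * (+ 1 + + 2 * n) * c) * (+ 2 * (+ 1 + + 2 * n) * c) - (+ 2 * (+ 1 + + 2 * n) * c) * (+ 2 * (+ 1 + + 2 * n) * c))
      ≡⟨ ℤ-solve (n ∷ c ∷ []) ⟩
    + 0 ∎)

  identity₃ : ∀ n → ∑ℚ n (summand₃ n) ≡ fromℤ (+ (2 ℕ.* n ℕ.+ 1) * (+ central n) ^ 2)
  identity₃ zero    = refl
  identity₃ (suc n) = *-cancelʳ-≡ _ _ d {{oneMinusTwo-nonZero (suc n)}} (begin
    (∑ℚ n (summand₃ (suc n)) +ℚ fromℤ p *ℚ d⁻¹) *ℚ d
      ≡⟨ cong (λ t → (t +ℚ fromℤ p *ℚ d⁻¹) *ℚ d) (begin
           ∑ℚ n (summand₃ (suc n))              ≡⟨ ∑ℚ-cong n summand₃-suc ⟩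
           ∑ℚ n (λ m → fromℤ (+ 16) *ℚ summand₃ n m) ≡⟨ ∑ℚ-*ˡ n (fromℤ (+ 16)) (summand₃ n) ⟩
           fromℤ (+ 16) *ℚ ∑ℚ n (summand₃ n)    ≡⟨ cong (fromℤ (+ 16) *ℚ_) (identity₃ n) ⟩
           fromℤ (+ 16) *ℚ fromℤ a              ∎) ⟩
    (fromℤ (+ 16) *ℚ fromℤ a +ℚ fromℤ p *ℚ d⁻¹) *ℚ d
      ≡⟨ distribute (fromℤ (+ 16)) (fromℤ a) (fromℤ p) d⁻¹ d ⟩
    fromℤ (+ 16) *ℚ fromℤ a *ℚ d +ℚ fromℤ p *ℚ (d⁻¹ *ℚ d)
      ≡⟨ cong (λ t → fromℤ (+ 16) *ℚ fromℤ a *ℚ d +ℚ fromℤ p *ℚ t)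
              (*-inverseˡ d {{oneMinusTwo-nonZero (suc n)}}) ⟩
    fromℤ (+ 16) *ℚ fromℤ a *ℚ d +ℚ fromℤ p *ℚ fromℤ (+ 1)
      ≡⟨ sym (trans (fromℤ-+ (+ 16 * a * D) (p * + 1))
                    (cong₂ _+ℚ_ (trans (fromℤ-* (+ 16 * a) D) (cong (_*ℚ d) (fromℤ-* (+ 16) a))) (fromℤ-* p (+ 1)))) ⟩
    fromℤ (+ 16 * a * D + p * + 1)
      ≡⟨ cong (λ e → fromℤ (+ 16 * a * D + c′ ^ 2 * (+ 16) ^ e * + 1)) (n∸n≡0 n) ⟩
    fromℤ (+ 16 * a * D + c′ ^ 2 * + 1 * + 1)
      ≡⟨ cong fromℤ (identity₃-step (+ n) _ _ _ (+ central n) c′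
                       (cong (_+ + 1) (pos-* 2 n)) (cong (+ 1 -_) (pos-* 2 (suc n)))
                       (cong (_+ + 1) (pos-* 2 (suc n))) (central-sucℤ n)) ⟩
    fromℤ (r * D)
      ≡⟨ fromℤ-* r D ⟩
    fromℤ r *ℚ d ∎)
    where
    d = oneMinusTwo (suc n)
    d⁻¹ = (1/ d) {{oneMinusTwo-nonZero (suc n)}}
    D = + 1 - + (2 ℕ.* suc n)
    c′ = + central (suc n)
    a = + (2 ℕ.* n ℕ.+ 1) * (+ central n) ^ 2
    p = c′ ^ 2 * (+ 16) ^ (suc n ∸ suc n)
    r = + (2 ℕ.* suc n ℕ.+ 1) * c′ ^ 2
    distribute : ∀ x y z u v → (x *ℚ y +ℚ z *ℚ u) *ℚ v ≡ x *ℚ y *ℚ v +ℚ z *ℚ (u *ℚ v)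
    distribute x y z u v = solve (x ∷ y ∷ z ∷ u ∷ v ∷ []) ℚ-ring

open Identity₁ using (identity₁-even; identity₁-odd; identity₄)
open Identity₂ using (identity₂)
open Identity₃ using (identity₃)

mainTheorem1 : ∀ (n : ℕ) →
      -- (1), n = 2k even
      (∀ (k : ℕ) → n ≡ 2 ℕ.* k →
        ∑ℤ n (λ m → (+ ((2 ℕ.* m) C m)) ℤ.^ 2 ℤ.* + ((n ℕ.+ m) C (n ∸ m)) ℤ.* (ℤ.- (+ 4)) ℤ.^ (n ∸ m))
          ≡ (+ ((2 ℕ.* k) C k)) ℤ.^ 2)
    × -- (1), n = 2k+1 odd
      (∀ (k : ℕ) → n ≡ suc (2 ℕ.* k) →
        ∑ℤ n (λ m → (+ ((2 ℕ.* m) C m)) ℤ.^ 2 ℤ.* + ((n ℕ.+ m) C (n ∸ m)) ℤ.* (ℤ.- (+ 4)) ℤ.^ (n ∸ m))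
          ≡ + 0)
    × -- (2)
      (∑ℚ n (λ m → fromℤ ((+ ((2 ℕ.* m) C m)) ℤ.^ 2)
                   ℚ.* binomℚ (fromℤ (+ n) ℚ.- ((+ 1) ℚ./ 2)) (n ∸ m)
                   ℚ.* fromℤ ((ℤ.- (+ 1)) ℤ.^ m ℤ.* (+ 16) ℤ.^ (n ∸ m)))
          ≡ fromℤ ((+ ((2 ℕ.* n) C n)) ℤ.^ 2))
    × -- (3)
      (∑ℚ n (λ m → ℚ._÷_ (fromℤ ((+ ((2 ℕ.* m) C m)) ℤ.^ 2 ℤ.* (+ 16) ℤ.^ (n ∸ m)))
                          (oneMinusTwo m) {{oneMinusTwo-nonZero m}})
          ≡ fromℤ (+ (2 ℕ.* n ℕ.+ 1) ℤ.* (+ ((2 ℕ.* n) C n)) ℤ.^ 2))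
    × -- (4)
      (∑ℤ (2 ℕ.* n) (λ m → (+ ((2 ℕ.* m) C m)) ℤ.^ 2 ℤ.* + ((2 ℕ.* n ℕ.+ m) C (2 ℕ.* m))
                            ℤ.* (ℤ.- (+ 1)) ℤ.^ m ℤ.* (+ 4) ℤ.^ (2 ℕ.* n ∸ m))
          ≡ (+ ((2 ℕ.* n) C n)) ℤ.^ 2)
mainTheorem1 n = identity₁-even , identity₁-odd , identity₂ n , identity₃ n , identity₄ n
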